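{- Let $\alpha$ be a countable ordinal and $\tau$ an order type. Suppose that for some $\sigma_0,\sigma_1\in\{\omega,\omega^*\}$ there is a pair of mutually coherent selectors $f_0:[\langle {}^\alpha 2,<_{\mathrm{lex}}\rangle]^\tau\rightharpoonup[\langle {}^\alpha 2,<_{\mathrm{lex}}\rangle]^{\sigma_0}$ and $f_1:[\langle {}^\alpha 2,<_{\mathrm{lex}}\rangle]^\tau\rightharpoonup[\langle {}^\alpha 2,<_{\mathrm{lex}}\rangle]^{\sigma_1}$ whose common domain is dense in $[\langle {}^\alpha 2,<_{\mathrm{lex}}\rangle]^\tau$. Then $\langle {}^\alpha 2,<_{\mathrm{lex}}\rangle\not\rightarrow(\tau)^\tau$.
   Context: Work in ZF. ${}^\alpha 2$ is the set of functions $\alpha\to\{0,1\}$ with the lexicographic order ($x<_{\mathrm{lex}}y$ iff $x(\delta)<y(\delta)$ for $\delta$ least with $x(\delta)\ne y(\delta)$). For a linear order $L$ and order type $\sigma$, $[L]^\sigma$ is the set of subsets of $L$ of induced order type $\sigma$. $\mathscr D\subseteq[L]^\tau$ is dense if every $A\in[L]^\tau$ has $[A]^\tau\cap\mathscr D\ne\emptyset$. A coherent selector is a partial function $f:[L]^\tau\rightharpoonup[L]^\sigma$ such that for all $A\in\mathrm{dom}f$: $f(A)\subseteq A$, and for every $B\in[f(A)]^\sigma$, $A'=(A\setminus f(A))\cup B\in\mathrm{dom}f$ and $f(A')=B$. Coherent selectors $f_0:[L]^\tau\rightharpoonup[L]^{\sigma_0}$, $f_1:[L]^\tau\rightharpoonup[L]^{\sigma_1}$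 are mutually coherent if $\mathrm{dom}f_0=\mathrm{dom}f_1$, $f_0(A)\cap f_1(A)=\emptyset$ for $A$ in this domain, and for every $A$ in the domain and all $B_0\in[f_0(A)]^{\sigma_0}$, $B_1\in[f_1(A)]^{\sigma_1}$, the set $A'=(A\setminus(f_0(A)\cup f_1(A)))\cup B_0\cup B_1$ lies in the domain and $f_i(A')=B_i$ for $i=0,1$. $L\rightarrow(\sigma)^\tau$ means: for every $F:[L]^\tau\to\{0,1\}$ there is $H\in[L]^\sigma$ with $F$ constant on $[H]^\tau$; $\not\rightarrow$ is its negation. -}

module Defs where

open import Level using (Level; 0ℓ) renaming (suc to lsuc)
open import Data.Nat using (ℕ)
import Data.Nat
import Data.Sum
import Relation.Binary.PropositionalEquality
import Data.Nat.Properties as ℕP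
open import Data.Bool using (Bool; true; false)
open import Data.Product using (Σ; ∃; _×_; _,_)
open import Data.Sum using (_⊎_)
open import Data.Empty using (⊥)
open import Relation.Nullary using (¬_)
open import Relation.Binary.Core using (Rel)
open import Relation.Binary.Structures using (IsStrictTotalOrder)
open import Induction.WellFounded using (WellFounded)
open import Relation.Binary.PropositionalEquality using (_≡_)
import Relation.Binary.Construct.Flip.EqAndOrd as Flip

record CountableOrdinal : Set₁ where
  field
    Carrier  : Set
    _≺_      : Rel Carrier 0ℓ
    isSTO    : IsStrictTotalOrder _≡_ _≺_
    wf       : WellFounded _≺_
    enc      : Carrier → ℕ
    enc-inj  : ∀ x y → enc x ≡ enc y → x ≡ y

record OrdType : Set₁ where
  field
    Carrier : Set
    _<_     : Rel Carrier 0ℓ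
    isSTO   : IsStrictTotalOrder _≡_ _<_

ω : OrdType
ω = record { Carrier = ℕ ; _<_ = Data.Nat._<_ ; isSTO = ℕP.<-isStrictTotalOrder }

ω* : OrdType
ω* = record { Carrier = ℕ ; _<_ = λ m n → n Data.Nat.< m
            ; isSTO = Flip.isStrictTotalOrder ℕP.<-isStrictTotalOrder }

ωOr* : Bool → OrdType
ωOr* false = ω
ωOr* true  = ω*

module _ (α : CountableOrdinal) where
  open CountableOrdinal α renaming (Carrier to A)

  Pt : Set
  Pt = A → Bool

  _≈_ : Pt → Pt → Set
  x ≈ y = ∀ γ → x γ ≡ y γ

  _<lex_ : Pt → Pt → Set
  x <lex y = ∃ λ δ → (∀ γ → γ ≺ δ → x γ ≡ y γ) × x δ ≡ false × y δ ≡ true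

  record Sub : Set₁ where
    field
      mem  : Pt → Set
      resp : ∀ {x y} → x ≈ y → mem x → mem y
  open Sub public

  _⊆_ : Sub → Sub → Set
  S ⊆ T = ∀ x → mem S x → mem T x

  _≐_ : Sub → Sub → Set
  S ≐ T = (S ⊆ T) × (T ⊆ S)

  _∖_ : Sub → Sub → Sub
  S ∖ T = record { mem  = λ x → mem S x × ¬ mem T x
                 ; resp = λ e (p , q) → resp S e p , λ r → q (resp T (λ γ → Relation.Binary.PropositionalEquality.sym (e γ)) r) }

  _∪_ : Sub → Sub → Sub
  S ∪ T = record { mem = λ x → mem S x ⊎ mem T x
                 ; resp = λ e → Data.Sum.map (resp S e) (resp T e) }

  Disjoint : Sub → Sub → Set
  Disjoint S T = ∀ x → ¬ (mem S x × mem T x)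

  HasType : OrdType → Sub → Set
  HasType σ S =
    Σ (Carrier → Pt) λ h →
        (∀ t → mem S (h t))
      × (∀ t t' → (t < t' → h t <lex h t') × (h t <lex h t' → t < t'))
      × (∀ x → mem S x → ∃ λ t → h t ≈ x)
    where open OrdType σ

  record IsPartialFn (τ σ : OrdType) (dom : Sub → Set₁)
                     (f : (S : Sub) → dom S → Sub) : Set₁ where
    field
      dom-type : ∀ {S} → dom S → HasType τ S
      dom-resp : ∀ {S S'} → S ≐ S' → dom S → dom S'
      f-resp   : ∀ {S S'} (d : dom S) (d' : dom S') → S ≐ S' → f S d ≐ f S' d'
      f-type   : ∀ {S} (d : dom S) → HasType σ (f S d)

  record IsCoherentSelector (τ σ : OrdType) (dom : Sub → Set₁)
                            (f : (S : Sub) → dom S → Sub) : Set₁ where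
    field
      partialFn : IsPartialFn τ σ dom f
      f-⊆       : ∀ {S} (d : dom S) → f S d ⊆ S
      coherent  : ∀ S (d : dom S) (B : Sub) → HasType σ B → B ⊆ f S d →
                  Σ (dom ((S ∖ f S d) ∪ B)) λ d' → f ((S ∖ f S d) ∪ B) d' ≐ B

  record IsMutuallyCoherent (τ σ₀ σ₁ : OrdType) (dom : Sub → Set₁)
                            (f₀ f₁ : (S : Sub) → dom S → Sub) : Set₁ where
    field
      coh₀     : IsCoherentSelector τ σ₀ dom f₀
      coh₁     : IsCoherentSelector τ σ₁ dom f₁
      disjoint : ∀ S (d : dom S) → Disjoint (f₀ S d) (f₁ S d)
      mutualCoh : ∀ S (d : dom S) (B₀ B₁ : Sub) →
                 HasType σ₀ B₀ → B₀ ⊆ f₀ S d →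
                 HasType σ₁ B₁ → B₁ ⊆ f₁ S d →
                 let S' = ((S ∖ (f₀ S d ∪ f₁ S d)) ∪ B₀) ∪ B₁ in
                 Σ (dom S') λ d' → (f₀ S' d' ≐ B₀) × (f₁ S' d' ≐ B₁)

  Dense : (τ : OrdType) → (Sub → Set₁) → Set₁
  Dense τ 𝒟 = ∀ S → HasType τ S → Σ Sub λ B → B ⊆ S × HasType τ B × 𝒟 B

  record Coloring (τ : OrdType) : Set₁ where
    field
      col  : (S : Sub) → HasType τ S → Bool
      resp : ∀ S S' (p : HasType τ S) (p' : HasType τ S') → S ≐ S' → col S p ≡ col S' p'

  Arrows : (σ τ : OrdType) → Set₁
  Arrows σ τ = (F : Coloring τ) → Σ Sub λ H → HasType σ H × ∃ λ c →
                 ∀ B (p : HasType τ B) → B ⊆ H → Coloring.col F B p ≡ c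

-- Colour A ∈ dom by whether the first two elements of f₀(A) split at an
-- earlier coordinate of α than the first two elements of f₁(A), coordinates
-- being compared through the injection of α into ℕ. In a subset of ^α 2 of
-- type ω or ω* that splitting coordinate can be pushed beyond any bound by
-- passing to a subsequence: bounds are passed one coordinate at a time, and by
-- the infinite pigeonhole principle some subsequence is constant at the
-- coordinate being passed, so no two of its terms split there. Mutual
-- coherence lets us replace f₀(A) or f₁(A) by such a subsequence inside A,
-- which flips the colour; so no A ∈ dom is monochromatic, and by density
-- neither is any H of type τ.
module Submission where

open import Defs
open import Level using (0ℓ; _⊔_; Lift; lift; lower) renaming (suc to lsuc)
open import Function using (_∘_; mk⇔)
open import Data.Bool using (Bool; true; false)
open import Data.Bool.Properties using (¬-not)
open import Data.Nat using (ℕ; zero; suc; _+_; _≤_; _<_; z≤n; s≤s; z<s; s<s)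
open import Data.Nat.Properties
  using ( ≤∧≢⇒<; <-trans; <-irrefl; <-cmp; <-≤-trans; m≤m+n; m≤n+m; +-monoʳ-<; +-monoˡ-<
        ; m≤n⇒m<n∨m≡n; _<?_)
open import Data.Product using (Σ; ∃; ∃₂; _×_; _,_; proj₁; proj₂)
open import Data.Sum using (_⊎_; inj₁; inj₂)
open import Data.Empty using (⊥-elim)
open import Relation.Nullary using (¬_; yes; no; does)
open import Relation.Nullary.Decidable using (map′; dec-true; dec-false; does-⇔)
open import Relation.Binary.Core using (_Preserves_⟶_)
open import Relation.Binary.Definitions using (tri<; tri≈; tri>)
open import Relation.Binary.Structures using (IsStrictTotalOrder)
open import Relation.Binary.PropositionalEquality using (_≡_; _≢_; refl; sym; trans; cong)
open import Axiom.ExcludedMiddle using (ExcludedMiddle)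

em-lower : ∀ {a b} → ExcludedMiddle (a ⊔ b) → ExcludedMiddle a
em-lower {b = b} em = map′ lower lift (em {Lift b _})

StrictlyIncreasing : (ℕ → ℕ) → Set
StrictlyIncreasing s = s Preserves _<_ ⟶ _<_

strictlyIncreasing-by-steps : ∀ {s} → (∀ k → s k < s (suc k)) → StrictlyIncreasing s
strictlyIncreasing-by-steps {s} step {i} {suc j} (s≤s i≤j) with m≤n⇒m<n∨m≡n i≤j
... | inj₁ i<j  = <-trans (strictlyIncreasing-by-steps step i<j) (step j)
... | inj₂ refl = step j

infinite-pigeonhole : ExcludedMiddle 0ℓ → (p : ℕ → Bool) →
                      ∃₂ λ s c → StrictlyIncreasing s × (∀ n → p (s n) ≡ c)
infinite-pigeonhole em p with em {∃ λ m → ∀ n → m ≤ n → p n ≡ false}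
... | yes (m , eventually-false) =
  (m +_) , false , +-monoʳ-< m , λ n → eventually-false (m + n) (m≤m+n m n)
... | no not-eventually-false =
  s , true , strictlyIncreasing-by-steps (λ k → proj₁ (proj₂ (next (suc (s k))))) , p∘s≡true
  where
  next : ∀ m → ∃ λ n → m ≤ n × p n ≡ true
  next m with em {∃ λ n → m ≤ n × p n ≡ true}
  ... | yes found = found
  ... | no none   = ⊥-elim (not-eventually-false
                      (m , λ n m≤n → ¬-not (λ pn≡true → none (n , m≤n , pn≡true))))

  s : ℕ → ℕ
  s zero    = proj₁ (next 0)
  s (suc k) = proj₁ (next (suc (s k)))

  p∘s≡true : ∀ n → p (s n) ≡ true
  p∘s≡true zero    = proj₂ (proj₂ (next 0))
  p∘s≡true (suc k) = proj₂ (proj₂ (next (suc (s k))))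

module Lex (α : CountableOrdinal) where
  open CountableOrdinal α renaming (Carrier to A)
  open IsStrictTotalOrder isSTO using (compare)

  Point : Set
  Point = Pt α

  infix 4 _≋_ _<ₗ_ _⊑_ _≅_

  _≋_ : Point → Point → Set
  _≋_ = _≈_ α

  _<ₗ_ : Point → Point → Set
  _<ₗ_ = _<lex_ α

  _⊑_ : Sub α → Sub α → Set
  _⊑_ = _⊆_ α

  _≅_ : Sub α → Sub α → Set
  _≅_ = _≐_ α

  ⊑-refl : ∀ {X} → X ⊑ X
  ⊑-refl _ x∈X = x∈X

  ⊑-trans : ∀ {X Y Z} → X ⊑ Y → Y ⊑ Z → X ⊑ Z
  ⊑-trans X⊑Y Y⊑Z x = Y⊑Z x ∘ X⊑Y x

  ≅-refl : ∀ {X} → X ≅ X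
  ≅-refl {X} = ⊑-refl {X} , ⊑-refl {X}

  ≅-sym : ∀ {X Y} → X ≅ Y → Y ≅ X
  ≅-sym (X⊑Y , Y⊑X) = Y⊑X , X⊑Y

  ≋-refl : ∀ {x} → x ≋ x
  ≋-refl γ = refl

  ≋-sym : ∀ {x y} → x ≋ y → y ≋ x
  ≋-sym x≋y γ = sym (x≋y γ)

  FirstDiff : Point → Point → A → Set
  FirstDiff x y δ = (∀ γ → γ ≺ δ → x γ ≡ y γ) × x δ ≢ y δ

  firstDiff-sym : ∀ {x y δ} → FirstDiff x y δ → FirstDiff y x δ
  firstDiff-sym (agree , differ) = (λ γ γ≺δ → sym (agree γ γ≺δ)) , differ ∘ sym

  firstDiff-resp : ∀ {x x′ y y′ δ} → x ≋ x′ → y ≋ y′ → FirstDiff x y δ → FirstDiff x′ y′ δ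
  firstDiff-resp x≋x′ y≋y′ (agree , differ) =
      (λ γ γ≺δ → trans (sym (x≋x′ γ)) (trans (agree γ γ≺δ) (y≋y′ γ)))
    , λ eq → differ (trans (x≋x′ _) (trans eq (sym (y≋y′ _))))

  firstDiff-unique : ∀ {x y δ δ′} → FirstDiff x y δ → FirstDiff x y δ′ → δ ≡ δ′
  firstDiff-unique {δ = δ} {δ′} (agree , differ) (agree′ , differ′) with compare δ δ′
  ... | tri< δ≺δ′ _ _ = ⊥-elim (differ (agree′ δ δ≺δ′))
  ... | tri≈ _ δ≡δ′ _ = δ≡δ′
  ... | tri> _ _ δ′≺δ = ⊥-elim (differ′ (agree δ′ δ′≺δ))

  <ₗ⇒firstDiff : ∀ {x y} → x <ₗ y → ∃ (FirstDiff x y)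
  <ₗ⇒firstDiff (δ , agree , xδ≡false , yδ≡true) =
    δ , agree , λ xδ≡yδ → false≢true (trans (sym xδ≡false) (trans xδ≡yδ yδ≡true))
    where
    false≢true : false ≢ true
    false≢true ()

  <ₗ-asym : ∀ {x y} → x <ₗ y → ¬ y <ₗ x
  <ₗ-asym x<y@(δ , _ , xδ≡false , _) y<x@(δ′ , _ , _ , xδ′≡true)
    with firstDiff-unique (proj₂ (<ₗ⇒firstDiff x<y)) (firstDiff-sym (proj₂ (<ₗ⇒firstDiff y<x)))
  ... | refl with trans (sym xδ≡false) xδ′≡true
  ... | ()

  <ₗ-resp : ∀ {x x′ y y′} → x ≋ x′ → y ≋ y′ → x <ₗ y → x′ <ₗ y′
  <ₗ-resp x≋x′ y≋y′ (δ , agree , xδ≡false , yδ≡true) =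
      δ , (λ γ γ≺δ → trans (sym (x≋x′ γ)) (trans (agree γ γ≺δ) (y≋y′ γ)))
    , trans (sym (x≋x′ δ)) xδ≡false , trans (sym (y≋y′ δ)) yδ≡true

  Precedes : Bool → Point → Point → Set
  Precedes false x y = x <ₗ y
  Precedes true  x y = y <ₗ x

  precedes-asym : ∀ b {x y} → Precedes b x y → ¬ Precedes b y x
  precedes-asym false = <ₗ-asym
  precedes-asym true  = <ₗ-asym

  precedes-irrefl : ∀ b {x} → ¬ Precedes b x x
  precedes-irrefl b x<x = precedes-asym b x<x x<x

  precedes-resp : ∀ b {x x′ y y′} → x ≋ x′ → y ≋ y′ → Precedes b x y → Precedes b x′ y′
  precedes-resp false x≋x′ y≋y′ = <ₗ-resp x≋x′ y≋y′
  precedes-resp true  x≋x′ y≋y′ = <ₗ-resp y≋y′ x≋x′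

  precedes⇒firstDiff : ∀ b {x y} → Precedes b x y → ∃ (FirstDiff x y)
  precedes⇒firstDiff false x<y = <ₗ⇒firstDiff x<y
  precedes⇒firstDiff true  y<x with <ₗ⇒firstDiff y<x
  ... | δ , diff = δ , firstDiff-sym diff

  Least : Bool → (Point → Set) → Point → Set
  Least b X m = X m × (∀ x → X x → x ≋ m ⊎ Precedes b m x)

  least-unique : ∀ b {X m m′} → Least b X m → Least b X m′ → m ≋ m′
  least-unique b (m∈X , m-least) (m′∈X , m′-least) with m-least _ m′∈X | m′-least _ m∈X
  ... | inj₁ m′≋m | _         = ≋-sym m′≋m
  ... | inj₂ _    | inj₁ m≋m′ = m≋m′
  ... | inj₂ m<m′ | inj₂ m′<m = ⊥-elim (precedes-asym b m<m′ m′<m)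

  least-cong : ∀ b {X Y : Point → Set} {m} →
               (∀ x → X x → Y x) → (∀ x → Y x → X x) → Least b X m → Least b Y m
  least-cong b X⊆Y Y⊆X (m∈X , m-least) = X⊆Y _ m∈X , λ x x∈Y → m-least x (Y⊆X x x∈Y)

  Others : Sub α → Point → Point → Set
  Others X m x = mem X x × ¬ x ≋ m

  record GapCode (b : Bool) (X : Sub α) (e : ℕ) : Set where
    constructor gapCode
    field
      {m₀ m₁}  : Point
      {δ}      : A
      m₀-least : Least b (mem X) m₀
      m₁-least : Least b (Others X m₀) m₁
      split    : FirstDiff m₀ m₁ δ
      code     : enc δ ≡ e

  gapCode-unique : ∀ {b X e e′} → GapCode b X e → GapCode b X e′ → e ≡ e′
  gapCode-unique {b} {X} (gapCode least₀ least₁ diff refl) (gapCode least₀′ least₁′ diff′ refl)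
    with least-unique b least₀ least₀′
  ... | m₀≋m₀′
    with least-unique b (least-cong b (others m₀≋m₀′) (others (≋-sym m₀≋m₀′)) least₁) least₁′
    where
    others : ∀ {m m′} → m ≋ m′ → ∀ x → Others X m x → Others X m′ x
    others m≋m′ x (x∈X , x≉m) = x∈X , λ x≋m′ → x≉m (λ γ → trans (x≋m′ γ) (sym (m≋m′ γ)))
  ... | m₁≋m₁′ = cong enc (firstDiff-unique (firstDiff-resp m₀≋m₀′ m₁≋m₁′ diff) diff′)

  gapCode-resp : ∀ {b X Y e} → X ≅ Y → GapCode b X e → GapCode b Y e
  gapCode-resp {b} {X} {Y} (X⊑Y , Y⊑X) (gapCode {m₀} least₀ least₁ diff code) =
    gapCode (least-cong b X⊑Y Y⊑X least₀)
            (least-cong b (others X Y X⊑Y) (others Y X Y⊑X) least₁) diff code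
    where
    others : ∀ U V → U ⊑ V → ∀ x → Others U m₀ x → Others V m₀ x
    others _ _ U⊑V x (x∈U , x≉m₀) = U⊑V x x∈U , x≉m₀

  Increasing : Bool → (ℕ → Point) → Set
  Increasing b g = g Preserves _<_ ⟶ Precedes b

  increasing-reflects : ∀ b {g} → Increasing b g → ∀ {i j} → Precedes b (g i) (g j) → i < j
  increasing-reflects b g↑ {i} {j} gi<gj with <-cmp i j
  ... | tri< i<j _ _  = i<j
  ... | tri≈ _ refl _ = ⊥-elim (precedes-irrefl b gi<gj)
  ... | tri> _ _ j<i  = ⊥-elim (precedes-asym b gi<gj (g↑ j<i))

  Enumerates : Bool → (ℕ → Point) → Sub α → Set
  Enumerates b g X = (∀ n → mem X (g n)) × Increasing b g × (∀ x → mem X x → ∃ λ n → g n ≋ x)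

  hasType⇒enumerated : ∀ b X → HasType α (ωOr* b) X → ∃ λ g → Enumerates b g X
  hasType⇒enumerated false _ (h , h∈X , iso , onto) = h , h∈X , (λ {i} {j} → proj₁ (iso i j)) , onto
  hasType⇒enumerated true  _ (h , h∈X , iso , onto) = h , h∈X , (λ {i} {j} → proj₁ (iso j i)) , onto

  image : (ℕ → Point) → Sub α
  image g = record
    { mem  = λ x → ∃ λ n → g n ≋ x
    ; resp = λ y≋z (n , gn≋y) → n , λ γ → trans (gn≋y γ) (y≋z γ)
    }

  enumerates-image : ∀ b {g} → Increasing b g → Enumerates b g (image g)
  enumerates-image b g↑ = (λ n → n , ≋-refl) , g↑ , λ x x∈image → x∈image

  image-hasType : ∀ b {g} → Increasing b g → HasType α (ωOr* b) (image g)
  image-hasType false {g} g↑ =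
    g , (λ n → n , ≋-refl) , (λ _ _ → g↑ , increasing-reflects false g↑) , λ _ x∈image → x∈image
  image-hasType true  {g} g↑ =
    g , (λ n → n , ≋-refl) , (λ _ _ → g↑ , increasing-reflects true g↑) , λ _ x∈image → x∈image

  gapCode-of-enumeration : ∀ b {g X δ} →
                           Enumerates b g X → FirstDiff (g 0) (g 1) δ → GapCode b X (enc δ)
  gapCode-of-enumeration b {g} {X} (g∈X , g↑ , onto) diff =
    gapCode (g∈X 0 , first) ((g∈X 1 , g1≉g0) , second) diff refl
    where
    g1≉g0 : ¬ g 1 ≋ g 0
    g1≉g0 g1≋g0 = precedes-irrefl b (precedes-resp b ≋-refl g1≋g0 (g↑ (z<s {0})))

    first : ∀ x → mem X x → x ≋ g 0 ⊎ Precedes b (g 0) x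
    first x x∈X with onto x x∈X
    ... | zero  , g0≋x = inj₁ (≋-sym g0≋x)
    ... | suc n , gn≋x = inj₂ (precedes-resp b ≋-refl gn≋x (g↑ z<s))

    second : ∀ x → Others X (g 0) x → x ≋ g 1 ⊎ Precedes b (g 1) x
    second x (x∈X , x≉g0) with onto x x∈X
    ... | zero , g0≋x        = ⊥-elim (x≉g0 (≋-sym g0≋x))
    ... | suc zero , g1≋x    = inj₁ (≋-sym g1≋x)
    ... | suc (suc n) , gn≋x = inj₂ (precedes-resp b ≋-refl gn≋x (g↑ (s<s z<s)))

  gapCode-exists : ∀ b X → HasType α (ωOr* b) X → ∃ (GapCode b X)
  gapCode-exists b X X-type with hasType⇒enumerated b X X-type
  ... | g , enum@(_ , g↑ , _) with precedes⇒firstDiff b (g↑ (z<s {0}))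
  ... | δ , diff = enc δ , gapCode-of-enumeration b enum diff

  Separated : (ℕ → Point) → Set
  Separated g = ∀ {i j} → i < j → ∃ (FirstDiff (g i) (g j))

  SplitsBeyond : ℕ → (ℕ → Point) → Set
  SplitsBeyond N g = ∃₂ λ i j → i < j × ∃ λ δ → FirstDiff (g i) (g j) δ × N ≤ enc δ

  separated-splitsBeyond : ExcludedMiddle 0ℓ → ∀ N {g} → Separated g → SplitsBeyond N g
  separated-splitsBeyond em zero sep with sep (z<s {0})
  ... | δ , diff = 0 , 1 , z<s , δ , diff , z≤n
  separated-splitsBeyond em (suc N) {g} sep with em {∃ λ γ → enc γ ≡ N}
  ... | no N∉codes with separated-splitsBeyond em N sep
  ...   | i , j , i<j , δ , diff , N≤δ =
          i , j , i<j , δ , diff , ≤∧≢⇒< N≤δ (λ N≡δ → N∉codes (δ , sym N≡δ))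
  separated-splitsBeyond em (suc N) {g} sep | yes (γ , γ≡N)
    with infinite-pigeonhole em (λ n → g n γ)
  ... | s , c , s↑ , g∘s-γ≡c with separated-splitsBeyond em N {g ∘ s} (sep ∘ s↑)
  ... | i , j , i<j , δ , diff@(_ , differ) , N≤δ =
    s i , s j , s↑ i<j , δ , diff , ≤∧≢⇒< N≤δ N≢δ
    where
    N≢δ : N ≢ enc δ
    N≢δ N≡δ with enc-inj δ γ (trans (sym N≡δ) (sym γ≡N))
    ... | refl = differ (trans (g∘s-γ≡c i) (sym (g∘s-γ≡c j)))

  jump : ℕ → ℕ → ℕ → ℕ
  jump i j zero    = i
  jump i j (suc n) = n + j

  jump-increasing : ∀ {i j} → i < j → StrictlyIncreasing (jump i j)
  jump-increasing {j = j} i<j {zero}  {suc n} _         = <-≤-trans i<j (m≤n+m j n)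
  jump-increasing {j = j} i<j {suc m} {suc n} (s<s m<n) = +-monoˡ-< j m<n

  deepGap-subset : ExcludedMiddle 0ℓ → ∀ b X → HasType α (ωOr* b) X → ∀ N →
                   Σ (Sub α) λ B → HasType α (ωOr* b) B × B ⊑ X × ∃ λ e → N ≤ e × GapCode b B e
  deepGap-subset em b X X-type N with hasType⇒enumerated b X X-type
  ... | h , h∈X , h↑ , _ with separated-splitsBeyond em N {h} (precedes⇒firstDiff b ∘ h↑)
  ... | i , j , i<j , δ , diff , N≤δ =
      image g , image-hasType b g↑ , (λ x (n , gn≋x) → resp X gn≋x (h∈X (jump i j n)))
    , enc δ , N≤δ , gapCode-of-enumeration b (enumerates-image b g↑) diff
    where
    g : ℕ → Point
    g = h ∘ jump i j

    g↑ : Increasing b g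
    g↑ = h↑ ∘ jump-increasing i<j

module Colouring (em : ExcludedMiddle (lsuc 0ℓ)) (α : CountableOrdinal) (τ : OrdType) (b₀ b₁ : Bool)
                 (dom : Sub α → Set₁) (f₀ f₁ : (S : Sub α) → dom S → Sub α)
                 (mc : IsMutuallyCoherent α τ (ωOr* b₀) (ωOr* b₁) dom f₀ f₁) where
  open Lex α
  open IsMutuallyCoherent mc
  open IsCoherentSelector coh₀ using () renaming (f-⊆ to f₀-⊆)
  open IsCoherentSelector coh₁ using () renaming (f-⊆ to f₁-⊆)
  module F₀ = IsPartialFn (IsCoherentSelector.partialFn coh₀)
  module F₁ = IsPartialFn (IsCoherentSelector.partialFn coh₁)

  GapsIncrease : Sub α → Set₁
  GapsIncrease S = Σ (dom S) λ d → ∃₂ λ e₀ e₁ →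
    GapCode b₀ (f₀ S d) e₀ × GapCode b₁ (f₁ S d) e₁ × e₀ < e₁

  gapsIncrease-resp : ∀ {S S′} → S ≅ S′ → GapsIncrease S → GapsIncrease S′
  gapsIncrease-resp S≅S′ (d , e₀ , e₁ , gap₀ , gap₁ , e₀<e₁) =
      d′ , e₀ , e₁ , gapCode-resp (F₀.f-resp d d′ S≅S′) gap₀
    , gapCode-resp (F₁.f-resp d d′ S≅S′) gap₁ , e₀<e₁
    where
    d′ = F₀.dom-resp S≅S′ d

  gapsIncrease-refuted : ∀ S (d : dom S) {e₀ e₁} →
    GapCode b₀ (f₀ S d) e₀ → GapCode b₁ (f₁ S d) e₁ → ¬ e₀ < e₁ → ¬ GapsIncrease S
  gapsIncrease-refuted S d gap₀ gap₁ e₀≮e₁ (d′ , _ , _ , gap₀′ , gap₁′ , e₀′<e₁′)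
    with gapCode-unique (gapCode-resp (F₀.f-resp d′ d (≅-refl {S})) gap₀′) gap₀
       | gapCode-unique (gapCode-resp (F₁.f-resp d′ d (≅-refl {S})) gap₁′) gap₁
  ... | refl | refl = e₀≮e₁ e₀′<e₁′

  colour : Sub α → Bool
  colour S = does (em {GapsIncrease S})

  colouring : Coloring α τ
  colouring = record
    { col  = λ S _ → colour S
    ; resp = λ S S′ _ _ S≅S′ →
        does-⇔ (mk⇔ (gapsIncrease-resp {S} {S′} S≅S′)
                    (gapsIncrease-resp {S′} {S} (≅-sym {S} {S′} S≅S′))) em em
    }

  exchange : ∀ A (d : dom A) B₀ B₁ →
    HasType α (ωOr* b₀) B₀ → B₀ ⊑ f₀ A d → HasType α (ωOr* b₁) B₁ → B₁ ⊑ f₁ A d →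
    Σ (Sub α) λ A′ → A′ ⊑ A × Σ (dom A′) λ d′ → B₀ ≅ f₀ A′ d′ × B₁ ≅ f₁ A′ d′
  exchange A d B₀ B₁ B₀-type B₀⊑f₀ B₁-type B₁⊑f₁
    with mutualCoh A d B₀ B₁ B₀-type B₀⊑f₀ B₁-type B₁⊑f₁
  ... | d′ , f₀≅B₀ , f₁≅B₁ =
    A′ , A′⊑A , d′ , ≅-sym {f₀ A′ d′} {B₀} f₀≅B₀ , ≅-sym {f₁ A′ d′} {B₁} f₁≅B₁
    where
    A′ : Sub α
    A′ = _∪_ α (_∪_ α (_∖_ α A (_∪_ α (f₀ A d) (f₁ A d))) B₀) B₁

    A′⊑A : A′ ⊑ A
    A′⊑A x (inj₁ (inj₁ (x∈A , _))) = x∈A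
    A′⊑A x (inj₁ (inj₂ x∈B₀))      = f₀-⊆ d x (B₀⊑f₀ x x∈B₀)
    A′⊑A x (inj₂ x∈B₁)             = f₁-⊆ d x (B₁⊑f₁ x x∈B₁)

  refuting-subset : ∀ A (d : dom A) {e₁} → GapCode b₁ (f₁ A d) e₁ →
                    Σ (Sub α) λ A′ → A′ ⊑ A × dom A′ × ¬ GapsIncrease A′
  refuting-subset A d {e₁} gap₁
    with deepGap-subset (em-lower em) b₀ (f₀ A d) (F₀.f-type d) e₁
  ... | B₀ , B₀-type , B₀⊑f₀ , e , e₁≤e , gapB₀
    with exchange A d B₀ (f₁ A d) B₀-type B₀⊑f₀ (F₁.f-type d) (⊑-refl {f₁ A d})
  ... | A′ , A′⊑A , d′ , B₀≅f₀ , f₁≅f₁ =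
    A′ , A′⊑A , d′ ,
    gapsIncrease-refuted A′ d′ (gapCode-resp B₀≅f₀ gapB₀) (gapCode-resp f₁≅f₁ gap₁)
                         (λ e<e₁ → <-irrefl refl (<-≤-trans e<e₁ e₁≤e))

  witnessing-subset : ∀ A (d : dom A) {e₀} → GapCode b₀ (f₀ A d) e₀ →
                      Σ (Sub α) λ A′ → A′ ⊑ A × GapsIncrease A′
  witnessing-subset A d {e₀} gap₀
    with deepGap-subset (em-lower em) b₁ (f₁ A d) (F₁.f-type d) (suc e₀)
  ... | B₁ , B₁-type , B₁⊑f₁ , e , e₀<e , gapB₁
    with exchange A d (f₀ A d) B₁ (F₀.f-type d) (⊑-refl {f₀ A d}) B₁-type B₁⊑f₁
  ... | A′ , A′⊑A , d′ , f₀≅f₀ , B₁≅f₁ =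
    A′ , A′⊑A , d′ , _ , e , gapCode-resp f₀≅f₀ gap₀ , gapCode-resp B₁≅f₁ gapB₁ , e₀<e

  ColouredBelow : Bool → Sub α → Set₁
  ColouredBelow c A = Σ (Sub α) λ B → B ⊑ A × HasType α τ B × colour B ≡ c

  both-colours-below : ∀ A → dom A → ColouredBelow true A × ColouredBelow false A
  both-colours-below A d
    with gapCode-exists b₀ (f₀ A d) (F₀.f-type d) | gapCode-exists b₁ (f₁ A d) (F₁.f-type d)
  ... | e₀ , gap₀ | e₁ , gap₁ with e₀ <? e₁
  ... | yes e₀<e₁ =
    (A , ⊑-refl {A} , F₀.dom-type d , dec-true em (d , e₀ , e₁ , gap₀ , gap₁ , e₀<e₁)) , refuted
    where
    refuted : ColouredBelow false A
    refuted with refuting-subset A d gap₁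
    ... | B , B⊑A , dB , ¬inc = B , B⊑A , F₀.dom-type dB , dec-false em ¬inc
  ... | no e₀≮e₁ =
    witnessed
    , (A , ⊑-refl {A} , F₀.dom-type d , dec-false em (gapsIncrease-refuted A d gap₀ gap₁ e₀≮e₁))
    where
    witnessed : ColouredBelow true A
    witnessed with witnessing-subset A d gap₀
    ... | B , B⊑A , inc@(dB , _) = B , B⊑A , F₀.dom-type dB , dec-true em inc

lemma14 : ExcludedMiddle (lsuc 0ℓ) →
    (α : CountableOrdinal) (τ : OrdType) (b₀ b₁ : Bool)
    (dom : Sub α → Set₁) (f₀ f₁ : (S : Sub α) → dom S → Sub α) →
    IsMutuallyCoherent α τ (ωOr* b₀) (ωOr* b₁) dom f₀ f₁ →
    Dense α τ dom →
    ¬ Arrows α τ τ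
lemma14 em α τ b₀ b₁ dom f₀ f₁ mc dense = no-homogeneous-set
  where
  open Colouring em α τ b₀ b₁ dom f₀ f₁ mc
  open Lex α using (⊑-trans)

  no-homogeneous-set : ¬ Arrows α τ τ
  no-homogeneous-set arrows with arrows colouring
  ... | H , H-type , c , monochromatic with dense H H-type
  ... | A , A⊑H , _ , d with both-colours-below A d
  ... | (B , B⊑A , B-type , B-true) , (B′ , B′⊑A , B′-type , B′-false)
    with trans (sym B-true) (monochromatic B B-type (⊑-trans {B} {A} {H} B⊑A A⊑H))
       | trans (sym B′-false) (monochromatic B′ B′-type (⊑-trans {B′} {A} {H} B′⊑A A⊑H))
  ... | refl | ()
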